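{- Let $G=(V,E)$ be a graph in $\mathcal{G}_{(\alpha,\beta)}$ and let $V^{*}=\bigcup_{v:\deg(v)\in\{1,2\}}\left(\{v\}\cup\mathcal{N}(v)\right)$. For every optimal half-integral solution $x$ of the vertex cover LP relaxation of $G$, \[x(V^{*})\ \ge\ \frac12\cdot\Big|\{u\in V \mid \deg(u)\ge 3 \text{ and } \exists v\in\mathcal{N}(u) \text{ with } \deg(v)\in\{1,2\}\}\Big|.\]
   Context: $\mathcal{G}_{(\alpha,\beta)}$ is the set of undirected multigraphs (self-loops and multi-edges allowed) with a prescribed power-law degree sequence (for $1\le i\le e^{\alpha/\beta}$ there are about $e^{\alpha}/i^{\beta}$ vertices of degree $i$). $\mathcal{N}(v)$ denotes the set of neighbours of $v$ and $\deg(v)$ its degree. The vertex cover LP relaxation is: minimize $\sum_{v\in V}x_v$ subject to $x_u+x_v\ge 1$ for every edge $\{u,v\}\in E$ and $x_v\ge 0$ for all $v$. A half-integral solution is one with all $x_v\in\{0,\tfrac12,1\}$ (an optimal such solution always exists by Nemhauser–Trotter). For $S\subseteq V$, $x(S)=\sum_{v\in S}x_v$. -}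

module Defs where

open import Data.Nat as ℕ using (ℕ; zero; suc)
open import Data.Fin using (Fin; zero; suc; _≟_)
open import Data.Fin.Properties using (any?)
open import Data.List using (List; map)
open import Data.Nat.ListAction using (sum)
open import Data.List.Relation.Unary.Any using (Any)
import Data.List.Relation.Unary.Any as Any
open import Data.Product using (_×_; _,_; proj₁; proj₂; ∃)
open import Data.Sum using (_⊎_)
open import Relation.Nullary using (Dec; does)
open import Relation.Nullary.Decidable using (_×-dec_; _⊎-dec_)
open import Relation.Binary.PropositionalEquality using (_≡_)
open import Data.Bool using (if_then_else_)
open import Data.Rational using (ℚ; 0ℚ; 1ℚ; _+_; _≤_)

-- A finite undirected multigraph on vertex set Fin n: a list of edges,
-- each an (unordered) pair of endpoints; self-loops (v , v) and repeated
-- edges are allowed.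
record MultiGraph : Set where
  field
    n     : ℕ
    edges : List (Fin n × Fin n)
open MultiGraph public

Vertex : MultiGraph → Set
Vertex G = Fin (n G)

endpoints : ∀ {m} → Fin m → Fin m × Fin m → ℕ
endpoints v (a , b) =
  (if does (a ≟ v) then 1 else 0) ℕ.+ (if does (b ≟ v) then 1 else 0)

-- degree (self-loops counted twice, multi-edges with multiplicity)
deg : (G : MultiGraph) → Vertex G → ℕ
deg G v = sum (map (endpoints v) (edges G))

EdgeJoins : ∀ {m} → Fin m → Fin m → Fin m × Fin m → Set
EdgeJoins v u (a , b) = (a ≡ v × b ≡ u) ⊎ (a ≡ u × b ≡ v)

Nbr : (G : MultiGraph) → Vertex G → Vertex G → Set
Nbr G v u = Any (EdgeJoins v u) (edges G)

nbr? : (G : MultiGraph) → (v u : Vertex G) → Dec (Nbr G v u)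
nbr? G v u = Any.any? (λ { (a , b) → ((a ≟ v) ×-dec (b ≟ u)) ⊎-dec ((a ≟ u) ×-dec (b ≟ v)) }) (edges G)

Low : (G : MultiGraph) → Vertex G → Set
Low G v = (deg G v ≡ 1) ⊎ (deg G v ≡ 2)

low? : (G : MultiGraph) → (v : Vertex G) → Dec (Low G v)
low? G v = (deg G v ℕ.≟ 1) ⊎-dec (deg G v ℕ.≟ 2)

InVstar : (G : MultiGraph) → Vertex G → Set
InVstar G w = Low G w ⊎ ∃ λ v → Low G v × Nbr G v w

inVstar? : (G : MultiGraph) → (w : Vertex G) → Dec (InVstar G w)
inVstar? G w = low? G w ⊎-dec any? (λ v → low? G v ×-dec nbr? G v w)

InU : (G : MultiGraph) → Vertex G → Set
InU G u = (3 ℕ.≤ deg G u) × ∃ λ v → Nbr G u v × Low G v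

inU? : (G : MultiGraph) → (u : Vertex G) → Dec (InU G u)
inU? G u = (3 ℕ.≤? deg G u) ×-dec any? (λ v → nbr? G u v ×-dec low? G v)

Σℚ : ∀ m → (Fin m → ℚ) → ℚ
Σℚ zero    f = 0ℚ
Σℚ (suc m) f = f zero + Σℚ m (λ i → f (suc i))

xOf : ∀ {m} {P : Fin m → Set} → ((i : Fin m) → Dec (P i)) → (Fin m → ℚ) → ℚ
xOf {m} P? x = Σℚ m (λ i → if does (P? i) then x i else 0ℚ)

card : ∀ {m} {P : Fin m → Set} → ((i : Fin m) → Dec (P i)) → ℚ
card {m} P? = Σℚ m (λ i → if does (P? i) then 1ℚ else 0ℚ)

-- Vertex cover LP: feasibility, objective, optimality (over rational points)
Feasible : (G : MultiGraph) → (Vertex G → ℚ) → Set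
Feasible G x = (∀ v → 0ℚ ≤ x v)
             × (∀ u v → Nbr G u v → 1ℚ ≤ x u + x v)

objective : (G : MultiGraph) → (Vertex G → ℚ) → ℚ
objective G x = Σℚ (n G) x

Optimal : (G : MultiGraph) → (Vertex G → ℚ) → Set
Optimal G x = Feasible G x × (∀ y → Feasible G y → objective G x ≤ objective G y)

HalfIntegral : (G : MultiGraph) → (Vertex G → ℚ) → Set
HalfIntegral G x = ∀ v → (x v ≡ 0ℚ) ⊎ (x v ≡ Data.Rational.½) ⊎ (x v ≡ 1ℚ)

-- Put h = 2x, so h takes values in {0, 1, 2} and h u + h v ≥ 2 on every edge.
-- A vertex u ∈ U with h u ≥ 1 pays for itself, since U ⊆ V*.  If h u = 0, the
-- low-degree neighbour v of u has h v = 2; such a v lies in V* but not in U, and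
-- having degree at most 2 it is charged by at most 2 = h v vertices of U.  Hence
-- |U| ≤ Σ_{w ∈ V*} h w = 2 x(V*).

module Submission where

open import Defs
open import Data.Bool.Base using (if_then_else_)
open import Data.Fin.Base using (Fin; zero; suc)
open import Data.Fin.Properties using (_≟_)
open import Data.Nat.Base as ℕ using (ℕ; zero; suc)
import Data.Nat.Properties as ℕ
open import Function.Base using (_∘_)
open import Relation.Nullary using (Dec; yes; no; does; ¬_; contradiction)
open import Relation.Nullary.Decidable using (_×-dec_; _⊎-dec_)
open import Relation.Binary.PropositionalEquality
open import Algebra.Properties.Semiring.Sum ℕ.+-*-semiring
  using (sum; sum-syntax; sum-cong-≗; sum-replicate-zero; ∑-distrib-+; ∑-comm; *-distribˡ-sum)

-- A separate module, so that ℕ's _+_, _*_ and _≤_ do not clash with the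
-- rational operators of the theorem statement.
module Counting where
  open import Data.Nat.Base using (_+_; _*_; _≤_; z≤n; s≤s)
  open import Data.Nat.Properties
    using (≤-refl; ≤-reflexive; ≤-trans; ≤-antisym; <-irrefl; m≤m+n; m≤n+m;
           +-mono-≤; +-monoʳ-≤; *-monoˡ-≤; *-monoʳ-≤; *-comm; *-identityʳ; +-identityʳ; *-distribʳ-+;
           module ≤-Reasoning)
  open import Data.List.Base using (List; []; _∷_; map)
  open import Data.List.Relation.Unary.Any as Any using (Any)
  import Data.Nat.ListAction as List
  open import Data.Product.Base using (_×_; _,_; proj₁; ∃)
  open import Data.Sum.Base using (inj₁; inj₂)
  open ≤-Reasoning

  private variable
    P Q R : Set

  𝟙 : Dec P → ℕ
  𝟙 P? = if does P? then 1 else 0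

  𝟙-yes : (P? : Dec P) → P → 𝟙 P? ≡ 1
  𝟙-yes (yes _) _ = refl
  𝟙-yes (no ¬p) p = contradiction p ¬p

  𝟙-no : (P? : Dec P) → ¬ P → 𝟙 P? ≡ 0
  𝟙-no (yes p) ¬p = contradiction p ¬p
  𝟙-no (no _)  _  = refl

  𝟙-mono : (P? : Dec P) (Q? : Dec Q) → (P → Q) → 𝟙 P? ≤ 𝟙 Q?
  𝟙-mono (yes p) Q? f = ≤-reflexive (sym (𝟙-yes Q? (f p)))
  𝟙-mono (no _)  Q? f = z≤n

  𝟙-×-dec : (P? : Dec P) (Q? : Dec Q) → 𝟙 (P? ×-dec Q?) ≡ 𝟙 P? * 𝟙 Q?
  𝟙-×-dec (yes _) Q? = sym (+-identityʳ (𝟙 Q?))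
  𝟙-×-dec (no _)  Q? = refl

  𝟙-⊎-dec : (P? : Dec P) (Q? : Dec Q) → 𝟙 (P? ⊎-dec Q?) ≤ 𝟙 P? + 𝟙 Q?
  𝟙-⊎-dec (yes _) Q? = m≤m+n 1 (𝟙 Q?)
  𝟙-⊎-dec (no _)  Q? = ≤-refl

  𝟙-disjoint : (P? : Dec P) (Q? : Dec Q) (R? : Dec R) →
               (P → R) → (Q → R) → (P → ¬ Q) → 𝟙 P? + 𝟙 Q? ≤ 𝟙 R?
  𝟙-disjoint (yes p) Q? R? P⇒R Q⇒R P⇒¬Q rewrite 𝟙-no Q? (P⇒¬Q p) = 𝟙-mono (yes p) R? P⇒R
  𝟙-disjoint (no _)  Q? R? P⇒R Q⇒R P⇒¬Q = 𝟙-mono Q? R? Q⇒R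

  𝟙*-monoʳ-≤ : ∀ {m n} (P? : Dec P) → (P → m ≤ n) → 𝟙 P? * m ≤ 𝟙 P? * n
  𝟙*-monoʳ-≤ (yes p) m≤n = *-monoʳ-≤ 1 (m≤n p)
  𝟙*-monoʳ-≤ (no _)  m≤n = z≤n

  𝟙≤𝟙*n+𝟙[n≡0] : (P? : Dec P) (n : ℕ) → 𝟙 P? ≤ 𝟙 P? * n + 𝟙 (P? ×-dec (n ℕ.≟ 0))
  𝟙≤𝟙*n+𝟙[n≡0] (yes _) zero    = ≤-refl
  𝟙≤𝟙*n+𝟙[n≡0] (yes _) (suc n) = s≤s z≤n
  𝟙≤𝟙*n+𝟙[n≡0] (no _)  n       = z≤n

  count : ∀ {m} {P : Fin m → Set} → (∀ i → Dec (P i)) → ℕ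
  count {m} P? = ∑[ i < m ] 𝟙 (P? i)

  weight : ∀ {m} {P : Fin m → Set} → (∀ i → Dec (P i)) → (Fin m → ℕ) → ℕ
  weight {m} P? h = ∑[ i < m ] (𝟙 (P? i) * h i)

  sum-mono-≤ : ∀ {m} {f g : Fin m → ℕ} → (∀ i → f i ≤ g i) → sum f ≤ sum g
  sum-mono-≤ {zero}  f≤g = z≤n
  sum-mono-≤ {suc m} f≤g = +-mono-≤ (f≤g zero) (sum-mono-≤ (f≤g ∘ suc))

  term≤sum : ∀ {m} (f : Fin m → ℕ) i → f i ≤ sum f
  term≤sum f zero    = m≤m+n (f zero) _
  term≤sum f (suc i) = ≤-trans (term≤sum (f ∘ suc) i) (m≤n+m _ (f zero))

  weight-mono-≤ : ∀ {m} {P : Fin m → Set} (P? : ∀ i → Dec (P i)) {f g : Fin m → ℕ} →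
                  (∀ i → P i → f i ≤ g i) → weight P? f ≤ weight P? g
  weight-mono-≤ P? f≤g = sum-mono-≤ (λ i → 𝟙*-monoʳ-≤ (P? i) (f≤g i))

  count-≟ : ∀ {m} (b : Fin m) → count (b ≟_) ≡ 1
  count-≟ {suc m} zero    = cong suc (sum-replicate-zero m)
  count-≟ {suc m} (suc b) = count-≟ b

  count≤weight-count : ∀ {m k} {P : Fin m → Set} {Q : Fin k → Set} {R : Fin k → Fin m → Set}
    (P? : ∀ u → Dec (P u)) (Q? : ∀ v → Dec (Q v)) (R? : ∀ v u → Dec (R v u)) →
    (∀ u → P u → ∃ λ v → Q v × R v u) → count P? ≤ weight Q? (λ v → count (R? v))
  count≤weight-count {m} {k} P? Q? R? witness = begin
    count P?
      ≤⟨ sum-mono-≤ covered ⟩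
    ∑[ u < m ] ∑[ v < k ] (𝟙 (Q? v) * 𝟙 (R? v u))
      ≡⟨ ∑-comm (λ u v → 𝟙 (Q? v) * 𝟙 (R? v u)) ⟩
    ∑[ v < k ] ∑[ u < m ] (𝟙 (Q? v) * 𝟙 (R? v u))
      ≡⟨ sum-cong-≗ (λ v → sym (*-distribˡ-sum (𝟙 (Q? v)) (λ u → 𝟙 (R? v u)))) ⟩
    weight Q? (λ v → count (R? v)) ∎
    where
    covered : ∀ u → 𝟙 (P? u) ≤ ∑[ v < k ] (𝟙 (Q? v) * 𝟙 (R? v u))
    covered u with P? u
    ... | no _  = z≤n
    ... | yes p with v , q , r ← witness u p = begin
      1                                   ≡⟨ sym (cong₂ _*_ (𝟙-yes (Q? v) q) (𝟙-yes (R? v u) r)) ⟩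
      𝟙 (Q? v) * 𝟙 (R? v u)               ≤⟨ term≤sum (λ v → 𝟙 (Q? v) * 𝟙 (R? v u)) v ⟩
      ∑[ v < k ] (𝟙 (Q? v) * 𝟙 (R? v u))  ∎

  joins? : ∀ {m} (v u : Fin m) e → Dec (EdgeJoins v u e)
  joins? v u (a , b) = ((a ≟ v) ×-dec (b ≟ u)) ⊎-dec ((a ≟ u) ×-dec (b ≟ v))

  count-joins≤endpoints : ∀ {m} (v : Fin m) e → count (λ u → joins? v u e) ≤ endpoints v e
  count-joins≤endpoints {m} v (a , b) = begin
    count (λ u → joins? v u (a , b))
      ≤⟨ sum-mono-≤ pointwise ⟩
    ∑[ u < m ] (𝟙 (a ≟ v) * 𝟙 (b ≟ u) + 𝟙 (b ≟ v) * 𝟙 (a ≟ u))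
      ≡⟨ ∑-distrib-+ (λ u → 𝟙 (a ≟ v) * 𝟙 (b ≟ u)) (λ u → 𝟙 (b ≟ v) * 𝟙 (a ≟ u)) ⟩
    ∑[ u < m ] (𝟙 (a ≟ v) * 𝟙 (b ≟ u)) + ∑[ u < m ] (𝟙 (b ≟ v) * 𝟙 (a ≟ u))
      ≡⟨ sym (cong₂ _+_ (*-distribˡ-sum (𝟙 (a ≟ v)) (λ u → 𝟙 (b ≟ u)))
                        (*-distribˡ-sum (𝟙 (b ≟ v)) (λ u → 𝟙 (a ≟ u)))) ⟩
    𝟙 (a ≟ v) * count (b ≟_) + 𝟙 (b ≟ v) * count (a ≟_)
      ≡⟨ cong₂ (λ s t → 𝟙 (a ≟ v) * s + 𝟙 (b ≟ v) * t) (count-≟ b) (count-≟ a) ⟩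
    𝟙 (a ≟ v) * 1 + 𝟙 (b ≟ v) * 1
      ≡⟨ cong₂ _+_ (*-identityʳ (𝟙 (a ≟ v))) (*-identityʳ (𝟙 (b ≟ v))) ⟩
    endpoints v (a , b) ∎
    where
    pointwise : ∀ u → 𝟙 (joins? v u (a , b)) ≤ 𝟙 (a ≟ v) * 𝟙 (b ≟ u) + 𝟙 (b ≟ v) * 𝟙 (a ≟ u)
    pointwise u = begin
      𝟙 (joins? v u (a , b))
        ≤⟨ 𝟙-⊎-dec ((a ≟ v) ×-dec (b ≟ u)) ((a ≟ u) ×-dec (b ≟ v)) ⟩
      𝟙 ((a ≟ v) ×-dec (b ≟ u)) + 𝟙 ((a ≟ u) ×-dec (b ≟ v))
        ≡⟨ cong₂ _+_ (𝟙-×-dec (a ≟ v) (b ≟ u))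
                     (trans (𝟙-×-dec (a ≟ u) (b ≟ v)) (*-comm (𝟙 (a ≟ u)) (𝟙 (b ≟ v)))) ⟩
      𝟙 (a ≟ v) * 𝟙 (b ≟ u) + 𝟙 (b ≟ v) * 𝟙 (a ≟ u) ∎

  count-neighbours≤endpoints : ∀ {m} (v : Fin m) (l : List (Fin m × Fin m)) →
    (N? : ∀ u → Dec (Any (EdgeJoins v u) l)) → count N? ≤ List.sum (map (endpoints v) l)
  count-neighbours≤endpoints {m} v [] N? =
    ≤-reflexive (trans (sum-cong-≗ (λ u → 𝟙-no (N? u) λ ())) (sum-replicate-zero m))
  count-neighbours≤endpoints {m} v (e ∷ l) N? = begin
    count N?
      ≤⟨ sum-mono-≤ split ⟩
    ∑[ u < m ] (𝟙 (joins? v u e) + 𝟙 (N′? u))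
      ≡⟨ ∑-distrib-+ (λ u → 𝟙 (joins? v u e)) (λ u → 𝟙 (N′? u)) ⟩
    count (λ u → joins? v u e) + count N′?
      ≤⟨ +-mono-≤ (count-joins≤endpoints v e) (count-neighbours≤endpoints v l N′?) ⟩
    List.sum (map (endpoints v) (e ∷ l)) ∎
    where
    N′? : ∀ u → Dec (Any (EdgeJoins v u) l)
    N′? u = Any.any? (joins? v u) l

    split : ∀ u → 𝟙 (N? u) ≤ 𝟙 (joins? v u e) + 𝟙 (N′? u)
    split u = ≤-trans (𝟙-mono (N? u) (joins? v u e ⊎-dec N′? u) Any.toSum)
                      (𝟙-⊎-dec (joins? v u e) (N′? u))

  count-neighbours≤deg : ∀ G (v : Vertex G) → count (nbr? G v) ≤ deg G v
  count-neighbours≤deg G v = count-neighbours≤endpoints v (edges G) (nbr? G v)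

  EdgeJoins-sym : ∀ {m} {u v : Fin m} e → EdgeJoins u v e → EdgeJoins v u e
  EdgeJoins-sym _ (inj₁ joins) = inj₂ joins
  EdgeJoins-sym _ (inj₂ joins) = inj₁ joins

  nbr-sym : ∀ G {u v : Vertex G} → Nbr G u v → Nbr G v u
  nbr-sym G = Any.map (λ {e} → EdgeJoins-sym e)

  low⇒deg≤2 : ∀ G v → Low G v → deg G v ≤ 2
  low⇒deg≤2 _ _ (inj₁ deg≡1) = ≤-trans (≤-reflexive deg≡1) (s≤s z≤n)
  low⇒deg≤2 _ _ (inj₂ deg≡2) = ≤-reflexive deg≡2

  InU⇒¬Low : ∀ G v → InU G v → ¬ Low G v
  InU⇒¬Low G v (3≤deg , _) low = <-irrefl refl (≤-trans 3≤deg (low⇒deg≤2 G v low))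

  -- h is twice a half-integral vertex cover.
  module DoubledCover (G : MultiGraph) (h : Vertex G → ℕ)
    (h≤2 : ∀ w → h w ≤ 2) (cover : ∀ u v → Nbr G u v → 2 ≤ h u + h v) where

    LowAtTwo : Vertex G → Set
    LowAtTwo v = Low G v × h v ≡ 2

    lowAtTwo? : ∀ v → Dec (LowAtTwo v)
    lowAtTwo? v = low? G v ×-dec (h v ℕ.≟ 2)

    UAtZero : Vertex G → Set
    UAtZero u = InU G u × h u ≡ 0

    uAtZero? : ∀ u → Dec (UAtZero u)
    uAtZero? u = inU? G u ×-dec (h u ℕ.≟ 0)

    UAtZero⇒lowAtTwo-neighbour : ∀ u → UAtZero u → ∃ λ v → LowAtTwo v × Nbr G v u
    UAtZero⇒lowAtTwo-neighbour u ((_ , v , u~v , low) , hu≡0) = v , (low , hv≡2) , nbr-sym G u~v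
      where
      hv≡2 : h v ≡ 2
      hv≡2 = ≤-antisym (h≤2 v) (subst (λ t → 2 ≤ t + h v) hu≡0 (cover u v u~v))

    count-UAtZero≤weight-LowAtTwo : count uAtZero? ≤ weight lowAtTwo? h
    count-UAtZero≤weight-LowAtTwo = begin
      count uAtZero?                      ≤⟨ count≤weight-count uAtZero? lowAtTwo? (nbr? G)
                                                                UAtZero⇒lowAtTwo-neighbour ⟩
      weight lowAtTwo? (count ∘ nbr? G)   ≤⟨ weight-mono-≤ lowAtTwo? neighbours≤h ⟩
      weight lowAtTwo? h                  ∎
      where
      neighbours≤h : ∀ v → LowAtTwo v → count (nbr? G v) ≤ h v
      neighbours≤h v (low , hv≡2) = begin
        count (nbr? G v)  ≤⟨ count-neighbours≤deg G v ⟩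
        deg G v           ≤⟨ low⇒deg≤2 G v low ⟩
        2                 ≡⟨ sym hv≡2 ⟩
        h v               ∎

    U∪LowAtTwo⊆Vstar : ∀ w → 𝟙 (inU? G w) * h w + 𝟙 (lowAtTwo? w) * h w ≤ 𝟙 (inVstar? G w) * h w
    U∪LowAtTwo⊆Vstar w = begin
      𝟙 (inU? G w) * h w + 𝟙 (lowAtTwo? w) * h w  ≡⟨ sym (*-distribʳ-+ (h w) (𝟙 (inU? G w)) _) ⟩
      (𝟙 (inU? G w) + 𝟙 (lowAtTwo? w)) * h w      ≤⟨ *-monoˡ-≤ (h w) disjoint ⟩
      𝟙 (inVstar? G w) * h w                      ∎
      where
      U⊆Vstar : InU G w → InVstar G w
      U⊆Vstar (_ , v , w~v , low) = inj₂ (v , low , nbr-sym G w~v)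

      disjoint : 𝟙 (inU? G w) + 𝟙 (lowAtTwo? w) ≤ 𝟙 (inVstar? G w)
      disjoint = 𝟙-disjoint (inU? G w) (lowAtTwo? w) (inVstar? G w)
                   U⊆Vstar (inj₁ ∘ proj₁) (λ u → InU⇒¬Low G w u ∘ proj₁)

    count-U≤weight-Vstar : count (inU? G) ≤ weight (inVstar? G) h
    count-U≤weight-Vstar = begin
      count (inU? G)
        ≤⟨ sum-mono-≤ (λ w → 𝟙≤𝟙*n+𝟙[n≡0] (inU? G w) (h w)) ⟩
      ∑[ w < n G ] (𝟙 (inU? G w) * h w + 𝟙 (uAtZero? w))
        ≡⟨ ∑-distrib-+ (λ w → 𝟙 (inU? G w) * h w) (λ w → 𝟙 (uAtZero? w)) ⟩
      weight (inU? G) h + count uAtZero?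
        ≤⟨ +-monoʳ-≤ (weight (inU? G) h) count-UAtZero≤weight-LowAtTwo ⟩
      weight (inU? G) h + weight lowAtTwo? h
        ≡⟨ sym (∑-distrib-+ (λ w → 𝟙 (inU? G w) * h w) (λ w → 𝟙 (lowAtTwo? w) * h w)) ⟩
      ∑[ w < n G ] (𝟙 (inU? G w) * h w + 𝟙 (lowAtTwo? w) * h w)
        ≤⟨ sum-mono-≤ U∪LowAtTwo⊆Vstar ⟩
      weight (inVstar? G) h ∎

open Counting using (𝟙; count; weight; module DoubledCover)

open import Algebra.Bundles using (Ring)
open import Data.Rational using (ℚ; ½; _*_; _≤_)
open import Data.Rational.Base using (0ℚ; 1ℚ; _+_; *≤*)
import Data.Rational.Properties as ℚ
open import Data.Integer.Base using (+≤+)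
open import Data.Product.Base using (_,_)
open import Data.Sum.Base using (_⊎_; inj₁; inj₂)
open import Algebra.Properties.Semiring.Mult (Ring.semiring ℚ.+-*-ring)
  using (_×_; ×-homo-+; ×-assocˡ; ×-comm-*)
open ℚ.≤-Reasoning

private variable
  P : Set

×-nonNeg : ∀ {c} n → 0ℚ ≤ c → 0ℚ ≤ n × c
×-nonNeg zero    0≤c = ℚ.≤-refl
×-nonNeg (suc n) 0≤c = ℚ.+-mono-≤ 0≤c (×-nonNeg n 0≤c)

×-monoˡ-≤ : ∀ {c m n} → 0ℚ ≤ c → m ℕ.≤ n → m × c ≤ n × c
×-monoˡ-≤ {n = n} 0≤c ℕ.z≤n = ×-nonNeg n 0≤c
×-monoˡ-≤ {c} 0≤c (ℕ.s≤s m≤n) = ℚ.+-monoʳ-≤ c (×-monoˡ-≤ 0≤c m≤n)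

Σℚ-cong : ∀ {m} {f g : Fin m → ℚ} → (∀ i → f i ≡ g i) → Σℚ m f ≡ Σℚ m g
Σℚ-cong {zero}  f≡g = refl
Σℚ-cong {suc m} f≡g = cong₂ _+_ (f≡g zero) (Σℚ-cong (f≡g ∘ suc))

Σℚ-× : ∀ {m} (f : Fin m → ℕ) c → Σℚ m (λ i → f i × c) ≡ sum f × c
Σℚ-× {zero}  f c = refl
Σℚ-× {suc m} f c = trans (cong (f zero × c +_) (Σℚ-× (f ∘ suc) c)) (sym (×-homo-+ c (f zero) _))

if-then-else-0≡𝟙× : (P? : Dec P) (a : ℚ) → (if does P? then a else 0ℚ) ≡ 𝟙 P? × a
if-then-else-0≡𝟙× (yes _) a = sym (ℚ.+-identityʳ a)
if-then-else-0≡𝟙× (no _)  a = refl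

*-card≡count× : ∀ {m} {P : Fin m → Set} (P? : ∀ i → Dec (P i)) c → c * card P? ≡ count P? × c
*-card≡count× P? c = begin-equality
  c * card P?
    ≡⟨ cong (c *_) (Σℚ-cong (λ i → if-then-else-0≡𝟙× (P? i) 1ℚ)) ⟩
  c * Σℚ _ (λ i → 𝟙 (P? i) × 1ℚ)
    ≡⟨ cong (c *_) (Σℚ-× (λ i → 𝟙 (P? i)) 1ℚ) ⟩
  c * (count P? × 1ℚ)
    ≡⟨ ×-comm-* (count P?) c 1ℚ ⟩
  count P? × (c * 1ℚ)
    ≡⟨ cong (count P? ×_) (ℚ.*-identityʳ c) ⟩
  count P? × c ∎

xOf≡weight× : ∀ {m} {P : Fin m → Set} (P? : ∀ i → Dec (P i)) {x : Fin m → ℚ} (h : Fin m → ℕ) c →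
        (∀ i → x i ≡ h i × c) → xOf P? x ≡ weight P? h × c
xOf≡weight× P? {x} h c x≡h×c = trans (Σℚ-cong pointwise) (Σℚ-× (λ i → 𝟙 (P? i) ℕ.* h i) c)
  where
  pointwise : ∀ i → (if does (P? i) then x i else 0ℚ) ≡ (𝟙 (P? i) ℕ.* h i) × c
  pointwise i = begin-equality
    (if does (P? i) then x i else 0ℚ)  ≡⟨ if-then-else-0≡𝟙× (P? i) (x i) ⟩
    𝟙 (P? i) × x i                    ≡⟨ cong (𝟙 (P? i) ×_) (x≡h×c i) ⟩
    𝟙 (P? i) × h i × c                ≡⟨ ×-assocˡ c (𝟙 (P? i)) (h i) ⟩
    (𝟙 (P? i) ℕ.* h i) × c            ∎

HalfIntegralValue : ℚ → Set
HalfIntegralValue a = (a ≡ 0ℚ) ⊎ (a ≡ ½) ⊎ (a ≡ 1ℚ)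

twice : ∀ {a} → HalfIntegralValue a → ℕ
twice (inj₁ _)        = 0
twice (inj₂ (inj₁ _)) = 1
twice (inj₂ (inj₂ _)) = 2

twice≤2 : ∀ {a} (a-half : HalfIntegralValue a) → twice a-half ℕ.≤ 2
twice≤2 (inj₁ _)        = ℕ.z≤n
twice≤2 (inj₂ (inj₁ _)) = ℕ.s≤s ℕ.z≤n
twice≤2 (inj₂ (inj₂ _)) = ℕ.≤-refl

≡twice×½ : ∀ {a} (a-half : HalfIntegralValue a) → a ≡ twice a-half × ½
≡twice×½ (inj₁ refl)        = refl
≡twice×½ (inj₂ (inj₁ refl)) = refl
≡twice×½ (inj₂ (inj₂ refl)) = refl

1≤k×½⇒2≤k : ∀ k → 1ℚ ≤ k × ½ → 2 ℕ.≤ k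
1≤k×½⇒2≤k 0             (*≤* (+≤+ ()))
1≤k×½⇒2≤k 1             (*≤* (+≤+ (ℕ.s≤s ())))
1≤k×½⇒2≤k (suc (suc k)) _ = ℕ.s≤s (ℕ.s≤s ℕ.z≤n)

mainTheorem3 : (G : MultiGraph) (x : Vertex G → ℚ)
    → Optimal G x → HalfIntegral G x
    → ½ * card (inU? G) ≤ xOf (inVstar? G) x
mainTheorem3 G x ((_ , cover) , _) half = begin
  ½ * card (inU? G)          ≡⟨ *-card≡count× (inU? G) ½ ⟩
  count (inU? G) × ½         ≤⟨ ×-monoˡ-≤ (ℚ.nonNegative⁻¹ ½) count-U≤weight-Vstar ⟩
  weight (inVstar? G) h × ½  ≡⟨ sym (xOf≡weight× (inVstar? G) h ½ (≡twice×½ ∘ half)) ⟩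
  xOf (inVstar? G) x         ∎
  where
  h : Vertex G → ℕ
  h = twice ∘ half

  doubled-cover : ∀ u v → Nbr G u v → 2 ℕ.≤ h u ℕ.+ h v
  doubled-cover u v u~v = 1≤k×½⇒2≤k (h u ℕ.+ h v) (begin
    1ℚ                     ≤⟨ cover u v u~v ⟩
    x u + x v              ≡⟨ cong₂ _+_ (≡twice×½ (half u)) (≡twice×½ (half v)) ⟩
    h u × ½ + h v × ½      ≡⟨ sym (×-homo-+ ½ (h u) (h v)) ⟩
    (h u ℕ.+ h v) × ½      ∎)

  open DoubledCover G h (twice≤2 ∘ half) doubled-cover using (count-U≤weight-Vstar)
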